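{- Let $x\in\mathbb{R}^m$, $y\in\mathbb{R}^n$, $z\in\mathbb{R}^o$, $p\in\mathbb{R}^m$, $q\in\mathbb{R}^n$, $r\in\mathbb{R}$, $A\in\mathbb{R}^{N\times m}$, $B\in\mathbb{R}^{N\times n}$, $C\in\mathbb{R}^{N\times o}$, $K\in\mathbb{R}^N$, and $b(x,z)=-K-Ax-Cz$. Let $J\subseteq\{1,\dots,N\}$ with $|J|=n$, and let $B_J$ and $b_J(x,z)$ be the $J$-indexed rows of $B$ and entries of $b(x,z)$. If $(B_J,q)$ is a refining pair, then $p^\top x + q^\top B_J^{ -1} b_J(x,z)\le r$ is a $Y$-antecedent of $p^\top x+q^\top y\le r$ in the context $By\le b(x,z)$. If $(B_J,q)$ is a relaxing pair, then $p^\top x + q^\top B_J^{ -1} b_J(x,z)\le r$ is a $Y$-consequent of $p^\top x+q^\top y\le r$ in the context $By\le b(x,z)$.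
   Context: $Y=\{y_1,\dots,y_n\}$. A formula $\psi(x,z)$ is a $Y$-antecedent of $\phi(x,y)$ in the context $\Gamma(x,y,z)$ if $\Gamma\land\psi\models\phi$, and a $Y$-consequent if $\Gamma\land\phi\models\psi$ ($\models$: every real assignment to all variables satisfying the left side satisfies the right side). For $M\in\mathbb{R}^{n\times n}$, $\nu\in\mathbb{R}^n$: $(M,\nu)$ is a refining pair if $M$ is invertible and $(M^\top)^{ -1}\nu\ge 0$ componentwise; it is a relaxing pair if $M$ is invertible and $-(M^\top)^{ -1}\nu\ge 0$ componentwise. -}

module Defs where

open import Level using (Level; _⊔_) renaming (suc to lsuc)
open import Data.Nat using (ℕ; zero; suc)
open import Data.Fin using (Fin) renaming (zero to fzero; suc to fsuc)
open import Data.Product using (Σ; _×_)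
open import Function using (_∘_)
open import Function.Definitions using (Injective)
open import Relation.Binary.PropositionalEquality using (_≡_)
open import Relation.Binary.Core using (Rel)
open import Relation.Binary.Structures using (IsTotalOrder)
open import Algebra.Bundles using (CommutativeRing)
import Data.Fin
import Relation.Nullary

-- An ordered commutative ring (ℝ with its usual order is an instance).
record OrderedCommRing (c ℓ₁ ℓ₂ : Level) : Set (lsuc (c ⊔ ℓ₁ ⊔ ℓ₂)) where
  field
    commutativeRing : CommutativeRing c ℓ₁
  open CommutativeRing commutativeRing public
  infix 4 _≤_
  field
    _≤_          : Rel Carrier ℓ₂
    isTotalOrder : IsTotalOrder _≈_ _≤_
    +-mono-≤     : ∀ {a b} c → a ≤ b → a + c ≤ b + c
    *-nonneg     : ∀ {a b} → 0# ≤ a → 0# ≤ b → 0# ≤ a * b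

module LinAlg {c ℓ₁ ℓ₂} (R : OrderedCommRing c ℓ₁ ℓ₂) where
  open OrderedCommRing R hiding (zero)

  Vec : ℕ → Set c
  Vec n = Fin n → Carrier

  Mat : ℕ → ℕ → Set c
  Mat k n = Fin k → Fin n → Carrier

  sumF : ∀ {n} → (Fin n → Carrier) → Carrier
  sumF {zero}  f = 0#
  sumF {suc n} f = f fzero + sumF (f ∘ fsuc)

  _·_ : ∀ {n} → Vec n → Vec n → Carrier
  u · v = sumF (λ i → u i * v i)

  _*ᵥ_ : ∀ {k n} → Mat k n → Vec n → Vec k
  (M *ᵥ v) i = sumF (λ j → M i j * v j)

  _*ₘ_ : ∀ {k n l} → Mat k n → Mat n l → Mat k l
  (M *ₘ P) i j = sumF (λ t → M i t * P t j)

  transpose : ∀ {k n} → Mat k n → Mat n k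
  transpose M i j = M j i

  identity : ∀ {n} → Mat n n
  identity i j with Data.Fin._≟_ i j
  ... | Relation.Nullary.yes _ = 1#
  ... | Relation.Nullary.no _  = 0#

  _≈ₘ_ : ∀ {k n} → Mat k n → Mat k n → Set ℓ₁
  M ≈ₘ P = ∀ i j → M i j ≈ P i j

  IsInverse : ∀ {n} → Mat n n → Mat n n → Set ℓ₁
  IsInverse M W = ((M *ₘ W) ≈ₘ identity) × ((W *ₘ M) ≈ₘ identity)

  Invertible : ∀ {n} → Mat n n → Set (c ⊔ ℓ₁)
  Invertible M = Σ (Mat _ _) (IsInverse M)

  Nonneg : ∀ {n} → Vec n → Set ℓ₂
  Nonneg v = ∀ i → 0# ≤ v i

  RefiningPair : ∀ {n} → Mat n n → Vec n → Set (c ⊔ ℓ₁ ⊔ ℓ₂)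
  RefiningPair M ν = Invertible M ×
    Σ (Mat _ _) (λ W → IsInverse (transpose M) W × Nonneg (W *ᵥ ν))

  RelaxingPair : ∀ {n} → Mat n n → Vec n → Set (c ⊔ ℓ₁ ⊔ ℓ₂)
  RelaxingPair M ν = Invertible M ×
    Σ (Mat _ _) (λ W → IsInverse (transpose M) W × Nonneg (λ i → - (W *ᵥ ν) i))

  YAntecedent : ∀ {m n o ℓa ℓb ℓc} →
    (Γ : Vec m → Vec n → Vec o → Set ℓa) →
    (ψ : Vec m → Vec o → Set ℓb) → (φ : Vec m → Vec n → Set ℓc) →
    Set (c ⊔ ℓa ⊔ ℓb ⊔ ℓc)
  YAntecedent Γ ψ φ = ∀ x y z → Γ x y z → ψ x z → φ x y

  YConsequent : ∀ {m n o ℓa ℓb ℓc} →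
    (Γ : Vec m → Vec n → Vec o → Set ℓa) →
    (ψ : Vec m → Vec o → Set ℓb) → (φ : Vec m → Vec n → Set ℓc) →
    Set (c ⊔ ℓa ⊔ ℓb ⊔ ℓc)
  YConsequent Γ ψ φ = ∀ x y z → Γ x y z → φ x y → ψ x z

  bvec : ∀ {N m o} → Vec N → Mat N m → Mat N o → Vec m → Vec o → Vec N
  bvec K A C x z i = ((- K i) - (A *ᵥ x) i) - (C *ᵥ z) i

  ctx : ∀ {N m n o} → Mat N n → Vec N → Mat N m → Mat N o →
        Vec m → Vec n → Vec o → Set ℓ₂
  ctx B K A C x y z = ∀ i → (B *ᵥ y) i ≤ bvec K A C x z i

  -- J-indexed rows / entries, J given as an injection Fin n → Fin N
  rowsJ : ∀ {N n k} → (Fin n → Fin N) → Mat N k → Mat n k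
  rowsJ J B i = B (J i)

  entriesJ : ∀ {N n} → (Fin n → Fin N) → Vec N → Vec n
  entriesJ J v i = v (J i)

{-# OPTIONS --safe #-}
-- Dualise the objective: with λ = (B_Jᵀ)⁻¹ q we have qᵀ = λᵀ B_J, so
-- qᵀ y = λᵀ (B_J y) and qᵀ B_J⁻¹ b_J = λᵀ b_J. The context gives B_J y ≤ b_J
-- row by row, and weighting these rows by λ ≥ 0 (refining) or λ ≤ 0 (relaxing)
-- compares qᵀ y with qᵀ B_J⁻¹ b_J in the required direction.
module Submission where

open import Defs
open import Level using (Level)
open import Data.Nat using (ℕ; zero; suc)
open import Data.Fin using (Fin; _≟_) renaming (zero to fzero; suc to fsuc)
open import Data.Product using (_×_; _,_)
open import Function using (_∘_)
open import Function.Definitions using (Injective)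
open import Relation.Binary.PropositionalEquality using (_≡_; cong) renaming (refl to ≡-refl)
open import Relation.Nullary using (yes; no)
open import Relation.Binary.Structures using (IsTotalOrder)
import Algebra.Properties.Ring as RingProperties
import Algebra.Properties.Semiring.Sum as SemiringSum
import Relation.Binary.Reasoning.Setoid as SetoidReasoning

module OrderedLinAlgProperties {c ℓ₁ ℓ₂} (R : OrderedCommRing c ℓ₁ ℓ₂) where
  open OrderedCommRing R hiding (zero)
  open LinAlg R
  open RingProperties ring using (x[y-z]≈xy-xz; //-rightDividesˡ; -‿distribˡ-*; -‿involutive)
  open SemiringSum semiring
    using (sum; sum-cong-≋; ∑-comm; *-distribˡ-sum; *-distribʳ-sum; sum-replicate-zero)
  open IsTotalOrder isTotalOrder
    using (≤-respˡ-≈; ≤-respʳ-≈) renaming (refl to ≤-refl; trans to ≤-trans)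
  open SetoidReasoning setoid

  sumF≡sum : ∀ {n} (f : Fin n → Carrier) → sumF f ≡ sum f
  sumF≡sum {zero}  f = ≡-refl
  sumF≡sum {suc n} f = cong (f fzero +_) (sumF≡sum (f ∘ fsuc))

  sumF-cong : ∀ {n} {f g : Fin n → Carrier} → (∀ i → f i ≈ g i) → sumF f ≈ sumF g
  sumF-cong {f = f} {g} f≈g = begin
    sumF f ≡⟨ sumF≡sum f ⟩
    sum f  ≈⟨ sum-cong-≋ f≈g ⟩
    sum g  ≡⟨ sumF≡sum g ⟨
    sumF g ∎

  sumF-comm : ∀ {m n} (f : Fin m → Fin n → Carrier) →
    sumF (λ i → sumF (f i)) ≈ sumF (λ j → sumF (λ i → f i j))
  sumF-comm {m} {n} f = begin
    sumF (λ i → sumF (f i))                ≈⟨ sumF-cong (λ i → reflexive (sumF≡sum (f i))) ⟩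
    sumF (λ i → sum (f i))                 ≡⟨ sumF≡sum {m} _ ⟩
    sum (λ i → sum (f i))                  ≈⟨ ∑-comm f ⟩
    sum (λ j → sum (λ i → f i j))          ≡⟨ sumF≡sum {n} _ ⟨
    sumF (λ j → sum (λ i → f i j))         ≈⟨ sumF-cong (λ j → reflexive (sumF≡sum (λ i → f i j))) ⟨
    sumF (λ j → sumF (λ i → f i j))        ∎

  *-distribˡ-sumF : ∀ {n} a (f : Fin n → Carrier) → a * sumF f ≈ sumF (λ i → a * f i)
  *-distribˡ-sumF {n} a f = begin
    a * sumF f              ≡⟨ cong (a *_) (sumF≡sum f) ⟩
    a * sum f               ≈⟨ *-distribˡ-sum a f ⟩
    sum (λ i → a * f i)     ≡⟨ sumF≡sum {n} _ ⟨
    sumF (λ i → a * f i)    ∎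

  *-distribʳ-sumF : ∀ {n} a (f : Fin n → Carrier) → sumF f * a ≈ sumF (λ i → f i * a)
  *-distribʳ-sumF {n} a f = begin
    sumF f * a              ≡⟨ cong (_* a) (sumF≡sum f) ⟩
    sum f * a               ≈⟨ *-distribʳ-sum a f ⟩
    sum (λ i → f i * a)     ≡⟨ sumF≡sum {n} _ ⟨
    sumF (λ i → f i * a)    ∎

  sumF-zero : ∀ {n} {f : Fin n → Carrier} → (∀ i → f i ≈ 0#) → sumF f ≈ 0#
  sumF-zero {n} f≈0 = trans (sumF-cong f≈0)
    (trans (reflexive (sumF≡sum (λ (_ : Fin n) → 0#))) (sum-replicate-zero n))

  identity-suc : ∀ {n} (i j : Fin n) → identity (fsuc i) (fsuc j) ≈ identity i j
  identity-suc i j with i ≟ j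
  ... | yes _ = refl
  ... | no _  = refl

  identity-*ᵥ : ∀ {n} (v : Vec n) i → (identity *ᵥ v) i ≈ v i
  identity-*ᵥ v fzero = begin
    1# * v fzero + sumF (λ j → 0# * v (fsuc j))
      ≈⟨ +-cong (*-identityˡ _) (sumF-zero (λ j → zeroˡ (v (fsuc j)))) ⟩
    v fzero + 0#  ≈⟨ +-identityʳ _ ⟩
    v fzero       ∎
  identity-*ᵥ v (fsuc i) = begin
    0# * v fzero + sumF (λ j → identity (fsuc i) (fsuc j) * v (fsuc j))
      ≈⟨ +-cong (zeroˡ _) (sumF-cong (λ j → *-congʳ (identity-suc i j))) ⟩
    0# + (identity *ᵥ (v ∘ fsuc)) i ≈⟨ +-identityˡ _ ⟩
    (identity *ᵥ (v ∘ fsuc)) i      ≈⟨ identity-*ᵥ (v ∘ fsuc) i ⟩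
    v (fsuc i)                      ∎

  *ₘ-*ᵥ-assoc : ∀ {k n l} (M : Mat k n) (P : Mat n l) (v : Vec l) i →
    ((M *ₘ P) *ᵥ v) i ≈ (M *ᵥ (P *ᵥ v)) i
  *ₘ-*ᵥ-assoc M P v i = begin
    sumF (λ j → sumF (λ t → M i t * P t j) * v j)
      ≈⟨ sumF-cong (λ j → *-distribʳ-sumF (v j) (λ t → M i t * P t j)) ⟩
    sumF (λ j → sumF (λ t → M i t * P t j * v j))
      ≈⟨ sumF-comm (λ j t → M i t * P t j * v j) ⟩
    sumF (λ t → sumF (λ j → M i t * P t j * v j))
      ≈⟨ sumF-cong (λ t → trans (sumF-cong (λ j → *-assoc (M i t) (P t j) (v j)))
                                (sym (*-distribˡ-sumF (M i t) (λ j → P t j * v j)))) ⟩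
    sumF (λ t → M i t * sumF (λ j → P t j * v j)) ∎

  transpose-*ᵥ-· : ∀ {k n} (M : Mat k n) (l : Vec k) (v : Vec n) →
    ((transpose M *ᵥ l) · v) ≈ (l · (M *ᵥ v))
  transpose-*ᵥ-· M l v = begin
    sumF (λ i → sumF (λ j → M j i * l j) * v i)
      ≈⟨ sumF-cong (λ i → *-distribʳ-sumF (v i) (λ j → M j i * l j)) ⟩
    sumF (λ i → sumF (λ j → M j i * l j * v i))
      ≈⟨ sumF-comm (λ i j → M j i * l j * v i) ⟩
    sumF (λ j → sumF (λ i → M j i * l j * v i))
      ≈⟨ sumF-cong (λ j → trans (sumF-cong (λ i → reorder (M j i) (l j) (v i)))
                                (sym (*-distribˡ-sumF (l j) (λ i → M j i * v i)))) ⟩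
    sumF (λ j → l j * sumF (λ i → M j i * v i)) ∎
    where
    reorder : ∀ a b d → a * b * d ≈ b * (a * d)
    reorder a b d = trans (*-congʳ (*-comm a b)) (*-assoc b a d)

  *ᵥ-rightInverse : ∀ {n} {M W : Mat n n} → (M *ₘ W) ≈ₘ identity →
    ∀ v i → (M *ᵥ (W *ᵥ v)) i ≈ v i
  *ᵥ-rightInverse {M = M} {W} MW≈I v i = begin
    (M *ᵥ (W *ᵥ v)) i       ≈⟨ *ₘ-*ᵥ-assoc M W v i ⟨
    ((M *ₘ W) *ᵥ v) i       ≈⟨ sumF-cong (λ j → *-congʳ (MW≈I i j)) ⟩
    (identity *ᵥ v) i       ≈⟨ identity-*ᵥ v i ⟩
    v i                     ∎

  ·-dual : ∀ {n} {M W : Mat n n} → (transpose M *ₘ W) ≈ₘ identity →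
    ∀ q v → (q · v) ≈ ((W *ᵥ q) · (M *ᵥ v))
  ·-dual {M = M} {W} Mᵀ*W≈I q v = begin
    q · v                          ≈⟨ sumF-cong (λ i → *-congʳ (*ᵥ-rightInverse Mᵀ*W≈I q i)) ⟨
    (transpose M *ᵥ (W *ᵥ q)) · v  ≈⟨ transpose-*ᵥ-· M (W *ᵥ q) v ⟩
    (W *ᵥ q) · (M *ᵥ v)            ∎

  ·-dual-inverse : ∀ {n} {M W M⁻¹ : Mat n n} → (transpose M *ₘ W) ≈ₘ identity →
    (M *ₘ M⁻¹) ≈ₘ identity → ∀ q b → (q · (M⁻¹ *ᵥ b)) ≈ ((W *ᵥ q) · b)
  ·-dual-inverse {M⁻¹ = M⁻¹} Mᵀ*W≈I M*M⁻¹≈I q b =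
    trans (·-dual Mᵀ*W≈I q (M⁻¹ *ᵥ b))
          (sumF-cong (λ i → *-congˡ (*ᵥ-rightInverse M*M⁻¹≈I b i)))

  +-monoʳ-≤ : ∀ x {a b} → a ≤ b → x + a ≤ x + b
  +-monoʳ-≤ x {a} {b} a≤b = ≤-respˡ-≈ (+-comm a x) (≤-respʳ-≈ (+-comm b x) (+-mono-≤ x a≤b))

  sumF-mono-≤ : ∀ {n} {f g : Fin n → Carrier} → (∀ i → f i ≤ g i) → sumF f ≤ sumF g
  sumF-mono-≤ {zero}  f≤g = ≤-refl
  sumF-mono-≤ {suc n} f≤g =
    ≤-trans (+-mono-≤ _ (f≤g fzero)) (+-monoʳ-≤ _ (sumF-mono-≤ (f≤g ∘ fsuc)))

  x≤y⇒0≤y-x : ∀ {x y} → x ≤ y → 0# ≤ y - x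
  x≤y⇒0≤y-x {x} x≤y = ≤-respˡ-≈ (-‿inverseʳ x) (+-mono-≤ (- x) x≤y)

  0≤y-x⇒x≤y : ∀ {x y} → 0# ≤ y - x → x ≤ y
  0≤y-x⇒x≤y {x} {y} 0≤y-x =
    ≤-respˡ-≈ (+-identityˡ x) (≤-respʳ-≈ (//-rightDividesˡ x y) (+-mono-≤ x 0≤y-x))

  neg-cancel-≤-≥ : ∀ {x y} → - x ≤ - y → y ≤ x
  neg-cancel-≤-≥ {x} {y} -x≤-y = 0≤y-x⇒x≤y (≤-respʳ-≈ -y--x≈x-y (x≤y⇒0≤y-x -x≤-y))
    where
    -y--x≈x-y : - y - - x ≈ x - y
    -y--x≈x-y = trans (+-congˡ (-‿involutive x)) (+-comm (- y) x)

  *-monoʳ-≤-nonNeg : ∀ {a u v} → 0# ≤ a → u ≤ v → a * u ≤ a * v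
  *-monoʳ-≤-nonNeg {a} {u} {v} 0≤a u≤v =
    0≤y-x⇒x≤y (≤-respʳ-≈ (x[y-z]≈xy-xz a v u) (*-nonneg 0≤a (x≤y⇒0≤y-x u≤v)))

  *-monoʳ-≤-nonPos : ∀ {a u v} → 0# ≤ - a → u ≤ v → a * v ≤ a * u
  *-monoʳ-≤-nonPos {a} {u} {v} 0≤-a u≤v = neg-cancel-≤-≥
    (≤-respˡ-≈ (sym (-‿distribˡ-* a u)) (≤-respʳ-≈ (sym (-‿distribˡ-* a v))
      (*-monoʳ-≤-nonNeg 0≤-a u≤v)))

  ·-monoʳ-≤-nonNeg : ∀ {n} {l u v : Vec n} → Nonneg l → (∀ i → u i ≤ v i) → (l · u) ≤ (l · v)
  ·-monoʳ-≤-nonNeg l≥0 u≤v = sumF-mono-≤ (λ i → *-monoʳ-≤-nonNeg (l≥0 i) (u≤v i))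

  ·-monoʳ-≤-nonPos : ∀ {n} {l u v : Vec n} → Nonneg (λ i → - l i) → (∀ i → u i ≤ v i) →
    (l · v) ≤ (l · u)
  ·-monoʳ-≤-nonPos -l≥0 u≤v = sumF-mono-≤ (λ i → *-monoʳ-≤-nonPos (-l≥0 i) (u≤v i))

  refiningPair-bound : ∀ {n} {M M⁻¹ : Mat n n} {q y b : Vec n} → RefiningPair M q →
    (M *ₘ M⁻¹) ≈ₘ identity → (∀ i → (M *ᵥ y) i ≤ b i) → (q · y) ≤ (q · (M⁻¹ *ᵥ b))
  refiningPair-bound {q = q} {y} {b} (_ , W , (Mᵀ*W≈I , _) , Wq≥0) M*M⁻¹≈I My≤b =
    ≤-respˡ-≈ (sym (·-dual Mᵀ*W≈I q y))
      (≤-respʳ-≈ (sym (·-dual-inverse Mᵀ*W≈I M*M⁻¹≈I q b))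
        (·-monoʳ-≤-nonNeg Wq≥0 My≤b))

  relaxingPair-bound : ∀ {n} {M M⁻¹ : Mat n n} {q y b : Vec n} → RelaxingPair M q →
    (M *ₘ M⁻¹) ≈ₘ identity → (∀ i → (M *ᵥ y) i ≤ b i) → (q · (M⁻¹ *ᵥ b)) ≤ (q · y)
  relaxingPair-bound {q = q} {y} {b} (_ , W , (Mᵀ*W≈I , _) , -Wq≥0) M*M⁻¹≈I My≤b =
    ≤-respˡ-≈ (sym (·-dual-inverse Mᵀ*W≈I M*M⁻¹≈I q b))
      (≤-respʳ-≈ (sym (·-dual Mᵀ*W≈I q y))
        (·-monoʳ-≤-nonPos -Wq≥0 My≤b))

corollary2 : ∀ {c ℓ₁ ℓ₂ : Level} (R : OrderedCommRing c ℓ₁ ℓ₂) →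
    let open OrderedCommRing R hiding (zero)
        open LinAlg R
    in ∀ (m n o N : ℕ)
         (p : Vec m) (q : Vec n) (r : Carrier)
         (A : Mat N m) (B : Mat N n) (C : Mat N o) (K : Vec N)
         (J : Fin n → Fin N) → Injective _≡_ _≡_ J →
         (BJinv : Mat n n) → IsInverse (rowsJ J B) BJinv →
         let Γ = λ (x : Vec m) (y : Vec n) (z : Vec o) → ctx B K A C x y z
             ψ = λ (x : Vec m) (z : Vec o) →
                   (p · x) + (q · (BJinv *ᵥ entriesJ J (bvec K A C x z))) ≤ r
             φ = λ (x : Vec m) (y : Vec n) → (p · x) + (q · y) ≤ r
         in (RefiningPair (rowsJ J B) q → YAntecedent Γ ψ φ)
          × (RelaxingPair (rowsJ J B) q → YConsequent Γ ψ φ)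
corollary2 R m n o N p q r A B C K J _ BJinv (B_J*BJinv≈I , _) =
    (λ refining x y z By≤b ψ →
      ≤-trans (+-monoʳ-≤ (p · x) (refiningPair-bound refining B_J*BJinv≈I (By≤b ∘ J))) ψ)
  , (λ relaxing x y z By≤b φ →
      ≤-trans (+-monoʳ-≤ (p · x) (relaxingPair-bound relaxing B_J*BJinv≈I (By≤b ∘ J))) φ)
  where
  open OrderedCommRing R hiding (zero)
  open LinAlg R
  open OrderedLinAlgProperties R
  open IsTotalOrder isTotalOrder using () renaming (trans to ≤-trans)
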